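{- Let $A$ be a finite nonempty alphabet and let $S\subset A^*$ be a connected set. Then for each $n\ge1$, the quotient $G_n(S)/\theta_n$ of the Rauzy graph $G_n(S)$ by the equivalence $\theta_n$ is isomorphic (as a labeled graph) to $G_{n-1}(S)$.
   Context: $S$ is factorial if it contains all factors of its elements. For $w\in S$: $L(w)=\{a\in A\mid aw\in S\}$, $R(w)=\{a\in A\mid wa\in S\}$, $E(w)=\{(a,b)\mid awb\in S\}$; $S$ is biextendable if factorial and $E(w)\neq\emptyset$ for all $w$. The extension graph $E(w)$ is the undirected bipartite graph with vertex set the disjoint union of $L(w)$ and $R(w)$ and an edge $a$–$b$ for each $(a,b)\in E(w)$. $S$ is connected if biextendable and every extension graph is connected. The Rauzy graph $G_n(S)$ has vertex set $S\cap A^n$ and an edge $(x,a,y)$ labeled $a\in A$ whenever $xa\in S\cap Ay$. The relation $\theta_n$ on $S\cap A^n$ consists of the pairs $(ax,bx)$ with $a,b\in L(x)$ such that there is a path in the extension graph $E(x)$ from the vertex $a$ to the vertex $b$ of the copy of $L(x)$. The quotient $G/\theta$ of a labeled graph by an equivalence has the classes as vertices and an edge labeled $a$ from class $C$ to class $D$ iff $G$ has an edge labeled $a$ from some vertex of $C$ to some vertex of $D$. A morphism of labeled graphs $G\to H$ is a surjective map $\varphi$ on vertices such that $(u,a,v)$ is an edge of $H$ iff there is an edge $(p,a,q)$ of $G$ with $\varphi(p)=u$, $\varphi(q)=v$; an isomorphism is a bijective morphism. -}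

module Defs where

open import Data.Nat using (ℕ; suc)
open import Data.Fin using (Fin)
open import Data.List using (List; []; _∷_; _++_; [_]; length)
open import Data.Product using (Σ; ∃; ∃-syntax; _×_; _,_)
open import Data.Sum using (_⊎_; inj₁; inj₂)
open import Data.Empty using (⊥)
open import Relation.Binary.PropositionalEquality using (_≡_)
open import Relation.Binary.Construct.Closure.ReflexiveTransitive using (Star)
open import Function.Bundles using (_⇔_)

module _ {A : Set} (S : List A → Set) where

  Factor : List A → List A → Set
  Factor u w = ∃[ p ] ∃[ s ] (w ≡ p ++ u ++ s)

  Factorial : Set
  Factorial = ∀ w u → S w → Factor u w → S u

  InL : List A → A → Set
  InL w a = S (a ∷ w)

  InR : List A → A → Set
  InR w b = S (w ++ [ b ])

  InE : List A → A → A → Set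
  InE w a b = S (a ∷ w ++ [ b ])

  Biextendable : Set
  Biextendable = Factorial × (∀ w → S w → ∃[ a ] ∃[ b ] InE w a b)

  -- Extension graph E(w): vertices are the disjoint union of L(w) (inj₁)
  -- and R(w) (inj₂); undirected edges a – b for (a,b) ∈ E(w).
  ExtVertex : List A → A ⊎ A → Set
  ExtVertex w (inj₁ a) = InL w a
  ExtVertex w (inj₂ b) = InR w b

  ExtAdj : List A → A ⊎ A → A ⊎ A → Set
  ExtAdj w (inj₁ a) (inj₂ b) = InE w a b
  ExtAdj w (inj₂ b) (inj₁ a) = InE w a b
  ExtAdj w (inj₁ _) (inj₁ _) = ⊥
  ExtAdj w (inj₂ _) (inj₂ _) = ⊥

  ExtPath : List A → A ⊎ A → A ⊎ A → Set
  ExtPath w u v = ExtVertex w u × ExtVertex w v × Star (ExtAdj w) u v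

  ExtConnected : List A → Set
  ExtConnected w = ∀ u v → ExtVertex w u → ExtVertex w v → ExtPath w u v

  Connected : Set
  Connected = Biextendable × (∀ w → S w → ExtConnected w)

-- Labeled graphs, with vertex set given up to an equivalence _≈_
-- (so that quotients can be represented as setoids).
record LGraph (A : Set) : Set₁ where
  field
    V    : Set
    _≈_  : V → V → Set
    Edge : V → A → V → Set

open LGraph

Quotient : {A : Set} (G : LGraph A) → (V G → V G → Set) → LGraph A
Quotient G θ = record
  { V = V G
  ; _≈_ = θ
  ; Edge = λ c a d → ∃[ p ] ∃[ q ] (θ c p × θ d q × Edge G p a q)
  }

record Morphism {A : Set} (G H : LGraph A) : Set where
  field
    φ     : V G → V H
    resp  : ∀ {x y} → _≈_ G x y → _≈_ H (φ x) (φ y)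
    surj  : ∀ y → ∃[ x ] _≈_ H (φ x) y
    edges : ∀ u a v → Edge H u a v ⇔
              (∃[ p ] ∃[ q ] (Edge G p a q × _≈_ H (φ p) u × _≈_ H (φ q) v))

record Isomorphism {A : Set} (G H : LGraph A) : Set where
  field
    morphism : Morphism G H
    inj      : ∀ {x y} → _≈_ H (Morphism.φ morphism x) (Morphism.φ morphism y)
                 → _≈_ G x y

module _ {A : Set} (S : List A → Set) where

  Vert : ℕ → Set
  Vert n = Σ (List A) (λ w → length w ≡ n × S w)

  word : ∀ {n} → Vert n → List A
  word (w , _) = w

  Rauzy : ℕ → LGraph A
  Rauzy n = record
    { V = Vert n
    ; _≈_ = λ u v → word u ≡ word v
    ; Edge = λ x a y → S (word x ++ [ a ]) × ∃[ b ] (word x ++ [ a ] ≡ b ∷ word y)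
    }

  θ : (n : ℕ) → Vert n → Vert n → Set
  θ n u v = ∃[ a ] ∃[ b ] ∃[ x ]
    (word u ≡ a ∷ x × word v ≡ b ∷ x × InL S x a × InL S x b
     × ExtPath S x (inj₁ a) (inj₁ b))

-- Deleting the first letter maps G_{m+1}(S) onto G_m(S): every edge x –c→ y of
-- G_m lifts to an edge ax –c→ by as soon as xc has a left extension a, and two
-- vertices ax, bx have the same image exactly when they are θ-related, because
-- the extension graph E(x) of a connected set joins any two letters of L(x).
module Submission where

open import Defs
open import Data.Nat using (ℕ; suc)
open import Data.Nat.Properties using (suc-injective)
open import Data.Fin using (Fin)
open import Data.List using (List; []; _∷_; _++_; [_]; length)
open import Data.List.Properties using (++-identityʳ; ∷-injectiveʳ)
open import Data.Product using (∃-syntax; _×_; _,_; proj₁; proj₂)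
open import Data.Sum using (inj₁)
open import Relation.Binary.PropositionalEquality using (_≡_; refl; sym; trans; cong; subst)
open import Relation.Binary.Construct.Closure.ReflexiveTransitive using (ε)
open import Function.Bundles using (_↔_; _⇔_; mk⇔)

module _ {A : Set} {S : List A → Set} where

  Factorial⇒tail : Factorial S → ∀ {a x} → S (a ∷ x) → S x
  Factorial⇒tail fact {a} {x} s =
    fact (a ∷ x) x s ([ a ] , [] , cong (a ∷_) (sym (++-identityʳ x)))

  Factorial⇒init : Factorial S → ∀ {w d} → S (w ++ [ d ]) → S w
  Factorial⇒init fact {w} {d} s = fact (w ++ [ d ]) w s ([] , [ d ] , refl)

  Biextendable⇒leftExtension : Biextendable S → ∀ {w} → S w → ∃[ a ] S (a ∷ w)
  Biextendable⇒leftExtension (fact , ext) {w} s with ext w s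
  ... | a , _ , sawb = a , Factorial⇒init fact sawb

  θ-refl : ∀ {n a x} (l : length (a ∷ x) ≡ n) (s : S (a ∷ x)) → θ S n (a ∷ x , l , s) (a ∷ x , l , s)
  θ-refl {a = a} {x} _ s = a , a , x , refl , refl , s , s , s , s , ε

  Rauzy-edge-resp : ∀ {n c} u u′ v v′ → word S u ≡ word S u′ → word S v ≡ word S v′ →
                    LGraph.Edge (Rauzy S n) u c v → LGraph.Edge (Rauzy S n) u′ c v′
  Rauzy-edge-resp (_ , _) (_ , _) (_ , _) (_ , _) refl refl e = e

  module _ (fact : Factorial S) {m : ℕ} where

    dropHead : Vert S (suc m) → Vert S m
    dropHead (_ ∷ x , l , s) = x , suc-injective l , Factorial⇒tail fact s

    dropHead-resp-θ : ∀ {u v} → θ S (suc m) u v → word S (dropHead u) ≡ word S (dropHead v)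
    dropHead-resp-θ {_ ∷ _ , _ , _} {_ ∷ _ , _ , _} (_ , _ , _ , refl , refl , _) = refl

    dropHead-edge : ∀ {p c q} → LGraph.Edge (Rauzy S (suc m)) p c q →
                    LGraph.Edge (Rauzy S m) (dropHead p) c (dropHead q)
    dropHead-edge {_ ∷ _ , _ , _} {c} {b ∷ _ , _ , _} (saxc , _ , eq) =
      Factorial⇒tail fact saxc , b , ∷-injectiveʳ eq

  module _ (biext : Biextendable S) {m : ℕ} where

    private
      fact = proj₁ biext

    dropHead-surjective : ∀ v → ∃[ u ] word S (dropHead fact {m} u) ≡ word S v
    dropHead-surjective (y , l , s) with Biextendable⇒leftExtension biext s
    ... | a , say = (a ∷ y , cong suc l , say) , refl

    liftEdge : ∀ {u c v} → LGraph.Edge (Rauzy S m) u c v →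
               ∃[ p ] ∃[ q ] (LGraph.Edge (Rauzy S (suc m)) p c q
                              × word S (dropHead fact p) ≡ word S u
                              × word S (dropHead fact q) ≡ word S v)
    liftEdge {x , lx , _} {c} {y , ly , _} (sxc , b , eq)
      with Biextendable⇒leftExtension biext sxc
    ... | a , saxc =
      (a ∷ x , cong suc lx , Factorial⇒init fact saxc)
      , (b ∷ y , cong suc ly , subst S eq sxc)
      , (saxc , a , cong (a ∷_) eq)
      , refl , refl

  module _ (conn : Connected S) {m : ℕ} where

    private
      fact = proj₁ (proj₁ conn)

    sameTail⇒θ : ∀ {u v} → word S (dropHead fact u) ≡ word S (dropHead fact v) →
                 θ S (suc m) u v
    sameTail⇒θ {a ∷ x , _ , sax} {b ∷ x , _ , sbx} refl =
      a , b , x , refl , refl , sax , sbx ,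
      proj₂ conn x (Factorial⇒tail fact sax) (inj₁ a) (inj₁ b) sax sbx

    LiftedEdge : Vert S m → A → Vert S m → Set
    LiftedEdge u c v =
      ∃[ p ] ∃[ q ] (LGraph.Edge (Quotient (Rauzy S (suc m)) (θ S (suc m))) p c q
                     × word S (dropHead fact p) ≡ word S u
                     × word S (dropHead fact q) ≡ word S v)

    quotientEdge⇔ : ∀ u c v → LGraph.Edge (Rauzy S m) u c v ⇔ LiftedEdge u c v
    quotientEdge⇔ u c v = mk⇔ to from
      where
      to : LGraph.Edge (Rauzy S m) u c v → LiftedEdge u c v
      to e with liftEdge (proj₁ conn) {m} {u} {c} {v} e
      ... | p@(_ ∷ _ , lp , sp) , q@(_ ∷ _ , lq , sq) , epq , refl , refl =
        p , q , (p , q , θ-refl lp sp , θ-refl lq sq , epq) , refl , refl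
      from : LiftedEdge u c v → LGraph.Edge (Rauzy S m) u c v
      from (p , q , (p′ , q′ , θpp′ , θqq′ , ep′q′) , pu , qv) =
        Rauzy-edge-resp (dropHead fact p′) u (dropHead fact q′) v
          (trans (sym (dropHead-resp-θ fact θpp′)) pu)
          (trans (sym (dropHead-resp-θ fact θqq′)) qv)
          (dropHead-edge fact ep′q′)

    dropHead-isomorphism : Isomorphism (Quotient (Rauzy S (suc m)) (θ S (suc m))) (Rauzy S m)
    dropHead-isomorphism = record
      { morphism = record
        { φ     = dropHead fact
        ; resp  = dropHead-resp-θ fact
        ; surj  = dropHead-surjective (proj₁ conn) {m}
        ; edges = quotientEdge⇔
        }
      ; inj = sameTail⇒θ
      }

proposition4p2 : (A : Set) (k : ℕ) → A ↔ Fin (suc k) →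
    (S : List A → Set) → Connected S →
    (m : ℕ) → Isomorphism (Quotient (Rauzy S (suc m)) (θ S (suc m))) (Rauzy S m)
proposition4p2 A k _ S conn m = dropHead-isomorphism conn
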